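{- Let $n\ge 0$, $m\ge 1$ be integers with $n+m\ge 3$, and let $$A=\{(0,i):i\in[3,10]\}\cup\{(1,i):i\in[2,9]\}\cup\{(2,i):i\in[1,8]\}\cup\{(3,i):i\in[1,6]\}\cup\{(4,i):i\in[1,5]\}\cup\{(5,1),(5,2),(5,3),(6,1)\}.$$ If $(n,m)\notin A$, then $\chi_{la}(Sp(2^{[n]},3^{[m]}))=n+m+2$.
   Context: For integers $a<b$, $[a,b]=\{a,a+1,\dots,b\}$. All graphs are finite, simple and connected. For a graph $G=(V,E)$ with $q=|E|$ edges, a local antimagic labeling of $G$ is a bijection $f:E\to\{1,\dots,q\}$ such that $f^+(x)\ne f^+(y)$ for every pair of adjacent vertices $x,y$, where $f^+(x)=\sum_{e\ni x} f(e)$. The local antimagic chromatic number $\chi_{la}(G)$ is the minimum, over all local antimagic labelings $f$ of $G$, of the number of distinct values taken by $f^+$. The spider $Sp(2^{[n]},3^{[m]})$ is the tree obtained from $n$ paths of length 2 and $m$ paths of length 3 (lengths counted in edges) by identifying one end-vertex of each of these $n+m$ paths into a single vertex (the core). -}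

module Defs where

open import Data.Nat using (ℕ; zero; suc; _+_; _*_; _≤_; _≟_)
open import Data.Fin using (Fin; toℕ)
import Data.Fin as F
open import Data.List using (List; []; _∷_; _++_; map; concatMap; allFin; length; deduplicate)
open import Data.Nat.ListAction using (sum)
open import Data.Product using (_×_; _,_; proj₁; proj₂; Σ)
open import Data.Sum using (_⊎_)
open import Data.Bool using (Bool; true; false; if_then_else_; _∨_)
open import Relation.Nullary using (¬_; Dec; yes; no; does)
open import Relation.Binary.PropositionalEquality using (_≡_; _≢_)
open import Function.Bundles using (_⤖_; Bijection)

-- A finite graph given by an explicit (complete, duplicate-free)
-- enumeration of its vertices and edges, and the endpoints of each edge.

record FinGraph : Set₁ where
  field
    V      : Set
    E      : Set
    _≟V_   : (x y : V) → Dec (x ≡ y)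
    verts  : List V
    edges  : List E
    ends   : E → V × V
    nEdges : ℕ

  incident : V → E → Bool
  incident x e = does (x ≟V proj₁ (ends e)) ∨ does (x ≟V proj₂ (ends e))

-- A labeling: a bijection E → {1,…,q}, encoded as a bijection E ⤖ Fin q,
-- edge e receiving label toℕ (f e) + 1.
Labeling : FinGraph → Set
Labeling G = FinGraph.E G ⤖ Fin (FinGraph.nEdges G)

label : (G : FinGraph) → Labeling G → FinGraph.E G → ℕ
label G f e = suc (toℕ (Bijection.to f e))

vsum : (G : FinGraph) → Labeling G → FinGraph.V G → ℕ
vsum G f x = sum (map (λ e → if FinGraph.incident G x e then label G f e else 0)
                      (FinGraph.edges G))

IsLocalAntimagic : (G : FinGraph) → Labeling G → Set
IsLocalAntimagic G f = (e : FinGraph.E G) →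
  vsum G f (proj₁ (FinGraph.ends G e)) ≢ vsum G f (proj₂ (FinGraph.ends G e))

numColors : (G : FinGraph) → Labeling G → ℕ
numColors G f = length (deduplicate _≟_ (map (vsum G f) (FinGraph.verts G)))

χla≡ : FinGraph → ℕ → Set
χla≡ G k =
  (Σ (Labeling G) λ f → IsLocalAntimagic G f × numColors G f ≡ k) ×
  ((f : Labeling G) → IsLocalAntimagic G f → k ≤ numColors G f)

-- The spider Sp(2^[n], 3^[m]).
-- Vertices: the core; leg2 i j (i-th leg of length 2, j-th non-core vertex,
-- j = 0 adjacent to the core); leg3 i j similarly for legs of length 3.

data SpV (n m : ℕ) : Set where
  core : SpV n m
  leg2 : Fin n → Fin 2 → SpV n m
  leg3 : Fin m → Fin 3 → SpV n m

data SpE (n m : ℕ) : Set where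
  e2 : Fin n → Fin 2 → SpE n m
  e3 : Fin m → Fin 3 → SpE n m

spEnds : ∀ {n m} → SpE n m → SpV n m × SpV n m
spEnds (e2 i F.zero)           = core , leg2 i F.zero
spEnds (e2 i (F.suc j))        = leg2 i (F.inject₁ j) , leg2 i (F.suc j)
spEnds (e3 i F.zero)           = core , leg3 i F.zero
spEnds (e3 i (F.suc j))        = leg3 i (F.inject₁ j) , leg3 i (F.suc j)

spV≟ : ∀ {n m} (x y : SpV n m) → Dec (x ≡ y)
spV≟ core core = yes _≡_.refl
spV≟ core (leg2 _ _) = no λ ()
spV≟ core (leg3 _ _) = no λ ()
spV≟ (leg2 _ _) core = no λ ()
spV≟ (leg2 i j) (leg2 i' j') with i F.≟ i' | j F.≟ j'
... | yes _≡_.refl | yes _≡_.refl = yes _≡_.refl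
... | no p | _ = no λ { _≡_.refl → p _≡_.refl }
... | yes _ | no q = no λ { _≡_.refl → q _≡_.refl }
spV≟ (leg2 _ _) (leg3 _ _) = no λ ()
spV≟ (leg3 _ _) core = no λ ()
spV≟ (leg3 _ _) (leg2 _ _) = no λ ()
spV≟ (leg3 i j) (leg3 i' j') with i F.≟ i' | j F.≟ j'
... | yes _≡_.refl | yes _≡_.refl = yes _≡_.refl
... | no p | _ = no λ { _≡_.refl → p _≡_.refl }
... | yes _ | no q = no λ { _≡_.refl → q _≡_.refl }

Spider : ℕ → ℕ → FinGraph
Spider n m = record
  { V      = SpV n m
  ; E      = SpE n m
  ; _≟V_   = spV≟
  ; verts  = core ∷ (concatMap (λ i → map (leg2 i) (allFin 2)) (allFin n)
                     ++ concatMap (λ i → map (leg3 i) (allFin 3)) (allFin m))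
  ; edges  = concatMap (λ i → map (e2 i) (allFin 2)) (allFin n)
             ++ concatMap (λ i → map (e3 i) (allFin 3)) (allFin m)
  ; ends   = spEnds
  ; nEdges = 2 * n + 3 * m
  }

InA : ℕ → ℕ → Set
InA n m =
     (n ≡ 0 × 3 ≤ m × m ≤ 10)
  ⊎ (n ≡ 1 × 2 ≤ m × m ≤ 9)
  ⊎ (n ≡ 2 × 1 ≤ m × m ≤ 8)
  ⊎ (n ≡ 3 × 1 ≤ m × m ≤ 6)
  ⊎ (n ≡ 4 × 1 ≤ m × m ≤ 5)
  ⊎ (n ≡ 5 × 1 ≤ m × m ≤ 3)
  ⊎ (n ≡ 6 × m ≡ 1)

module Submission where

-- Write q = 2n + 3m for the number of edges and k = n + m for the number of legs.
-- Lower bound, valid for every labeling: the core sum S is a sum of k distinct labels, so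
-- 2S ≥ k(k + 1), and outside A this is at least 4q; hence S ≥ 2q.  The edge labelled q has an
-- endpoint of degree two whose sum lies strictly between q and 2q, and the k leaves carry k
-- distinct sums of at most q, which makes k + 2 distinct vertex sums.
-- Upper bound: a labeling in which every neighbour of a leaf sums to q + 1 and every core
-- neighbour on a 3-leg sums to a leaf label takes only the k leaf labels, q + 1 and S as sums.

open import Defs
open import Data.Nat
  using (ℕ; zero; suc; pred; _+_; _*_; _≤_; _<_; _≤′_; ≤′-refl; ≤′-step; _≤?_; _≟_; z≤n; s≤s; z<s; NonZero; >-nonZero)
open import Data.Nat.Properties
open import Data.Nat.Tactic.RingSolver using (solve-∀)
open import Data.Fin as Fin using (Fin; toℕ; fromℕ<; opposite; _↑ˡ_; _↑ʳ_; splitAt; join)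
open import Data.Fin.Properties as Finₚ
  using (toℕ<n; injective⇒≤; +↔⊎; opposite-involutive; toℕ-cast; toℕ-↑ˡ; toℕ-↑ʳ)
open import Data.Fin.Patterns using (0F; 1F; 2F)
open import Data.Vec.Functional using (removeAt)
import Data.Vec.Functional as Vector
open import Data.List using (List; []; _∷_; map; allFin; tabulate; length; lookup; deduplicate; concatMap)
open import Data.List.Properties using (map-tabulate; length-tabulate; map-∘; map-++; map-concatMap)
open import Data.Nat.ListAction using (sum)
open import Data.Nat.ListAction.Properties using (sum-++)
open import Data.List.Membership.Propositional using (_∈_)
open import Data.List.Membership.Propositional.Properties
  using (∈-tabulate⁺; ∈-lookup; ∈-map⁺; ∈-map⁻; ∈-deduplicate⁺; ∈-deduplicate⁻; ∈-++⁺ˡ; ∈-++⁺ʳ; ∈-concat⁺′; ∈-allFin)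
open import Data.List.Relation.Unary.Unique.DecPropositional.Properties using (deduplicate-!)
open import Data.List.Relation.Unary.Any using (here; there; index)
open import Data.List.Relation.Unary.Any.Properties using (lookup-index)
import Data.List.Relation.Unary.All as All
open import Data.List.Relation.Unary.Unique.Propositional using (Unique; _∷_)
open import Data.Sum using (_⊎_; inj₁; inj₂; [_,_])
open import Data.Product using (∃; _×_; _,_; proj₁; proj₂)
open import Function using (_∘_)
open import Function.Definitions using (Injective)
open import Function.Bundles using (Bijection; _↔_; mk↔ₛ′)
open import Function.Properties.Inverse using (↔-refl; ↔-sym; ↔-trans; ↔⇒⤖)
open import Data.Sum.Function.Propositional using (_⊎-↔_)
open import Relation.Nullary using (¬_; yes; no; does; contradiction)
open import Relation.Nullary.Decidable using (dec-true; dec-false)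
open import Data.Bool using (true; false; if_then_else_)
open import Relation.Binary.PropositionalEquality
  using (_≡_; _≢_; refl; sym; trans; cong; cong₂; subst; module ≡-Reasoning)

open import Algebra.Properties.CommutativeMonoid.Sum +-0-commutativeMonoid
  using (sum-syntax; sum-cong-≗; sum-remove; sum-replicate-zero)
  renaming (sum to ∑)
open import Algebra.Properties.CommutativeSemigroup +-commutativeSemigroup using (x∙yz≈y∙xz)

sum-tabulate : ∀ {k} (h : Fin k → ℕ) → sum (tabulate h) ≡ ∑ h
sum-tabulate {zero}  h = refl
sum-tabulate {suc k} h = cong (h 0F +_) (sum-tabulate (h ∘ Fin.suc))

sum-map-allFin : ∀ {k} (h : Fin k → ℕ) → sum (map h (allFin k)) ≡ ∑ h
sum-map-allFin h = trans (cong sum (map-tabulate (λ i → i) h)) (sum-tabulate h)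

∑-≡0 : ∀ {k} (h : Fin k → ℕ) → (∀ i → h i ≡ 0) → ∑ h ≡ 0
∑-≡0 {k} h h≡0 = trans (sum-cong-≗ h≡0) (sum-replicate-zero k)

∑-single : ∀ {k} (h : Fin k → ℕ) p → (∀ i → i ≢ p → h i ≡ 0) → ∑ h ≡ h p
∑-single {suc k} h p h≡0 = begin
  ∑ h                    ≡⟨ sum-remove h ⟩
  h p + ∑ (removeAt h p) ≡⟨ cong (h p +_) (∑-≡0 _ (λ i → h≡0 _ (Finₚ.punchInᵢ≢i p i))) ⟩
  h p + 0                ≡⟨ +-identityʳ (h p) ⟩
  h p                    ∎
  where open ≡-Reasoning

∑-suc : ∀ {k} (h : Fin k → ℕ) → ∑ (suc ∘ h) ≡ k + ∑ h
∑-suc {zero}  h = refl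
∑-suc {suc k} h = cong suc (trans (cong (h 0F +_) (∑-suc (h ∘ Fin.suc))) (x∙yz≈y∙xz (h 0F) k _))

∑-↑ : ∀ n {m} (h : Fin (n + m) → ℕ) → ∑ h ≡ ∑ (h ∘ (_↑ˡ m)) + ∑ (h ∘ (n ↑ʳ_))
∑-↑ zero    h = refl
∑-↑ (suc n) h = trans (cong (h 0F +_) (∑-↑ n (h ∘ Fin.suc))) (sym (+-assoc (h 0F) _ _))

sum-concatMap : ∀ {B : Set} (g : B → List ℕ) xs → sum (concatMap g xs) ≡ sum (map (sum ∘ g) xs)
sum-concatMap g []       = refl
sum-concatMap g (x ∷ xs) = trans (sum-++ (g x) _) (cong (sum (g x) +_) (sum-concatMap g xs))

sum-map-allFin² : ∀ {B : Set} {k r} (c : B → ℕ) (g : Fin k → Fin r → B) →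
  sum (map c (concatMap (λ i → map (g i) (allFin r)) (allFin k))) ≡ ∑[ i < k ] ∑[ s < r ] c (g i s)
sum-map-allFin² {k = k} {r} c g = begin
  sum (map c (concatMap (λ i → map (g i) (allFin r)) (allFin k)))  ≡⟨ cong sum (map-concatMap c _ (allFin k)) ⟩
  sum (concatMap (λ i → map c (map (g i) (allFin r))) (allFin k))  ≡⟨ sum-concatMap _ (allFin k) ⟩
  sum (map (λ i → sum (map c (map (g i) (allFin r)))) (allFin k))  ≡⟨ sum-map-allFin (λ i → sum (map c (map (g i) (allFin r)))) ⟩
  ∑[ i < k ] sum (map c (map (g i) (allFin r)))                     ≡⟨ sum-cong-≗ inner ⟩
  ∑[ i < k ] ∑[ s < r ] c (g i s)                                   ∎
  where
  open ≡-Reasoning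
  inner : ∀ i → sum (map c (map (g i) (allFin r))) ≡ ∑[ s < r ] c (g i s)
  inner i = trans (cong sum (sym (map-∘ (allFin r)))) (sum-map-allFin (c ∘ g i))

distinct-below⇒≤ : ∀ N {k} (h : Fin k → ℕ) → Injective _≡_ _≡_ h → (∀ i → h i < N) → k ≤ N
distinct-below⇒≤ N h inj h<N = injective⇒≤ (λ eq → inj (begin
  h _                    ≡⟨ Finₚ.toℕ-fromℕ< (h<N _) ⟨
  toℕ (fromℕ< (h<N _))   ≡⟨ cong toℕ eq ⟩
  toℕ (fromℕ< (h<N _))   ≡⟨ Finₚ.toℕ-fromℕ< (h<N _) ⟩
  h _                    ∎))
  where open ≡-Reasoning

∑-distinct-≥ : ∀ N {k} (h : Fin k → ℕ) → Injective _≡_ _≡_ h → (∀ i → h i < N) →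
               k * k ≤ 2 * ∑ h + k
∑-distinct-≥ N       {zero}  h inj h<N = z≤n
∑-distinct-≥ zero    {suc k} h inj h<N = contradiction (h<N 0F) n≮0
∑-distinct-≥ (suc N) {suc k} h inj h<N with Finₚ.any? (λ i → h i ≟ N)
... | no  N∉h = ∑-distinct-≥ N h inj (λ i → ≤∧≢⇒< (<⇒≤pred (h<N i)) (λ h≡N → N∉h (i , h≡N)))
... | yes (p , hp≡N) = begin
  suc k * suc k               ≡⟨ expand k ⟩
  k * k + 2 * k + 1           ≤⟨ +-monoˡ-≤ 1 (+-mono-≤ (∑-distinct-≥ N h′ h′-inj h′<N) (*-monoʳ-≤ 2 k≤N)) ⟩
  2 * ∑ h′ + k + 2 * N + 1    ≡⟨ regroup (∑ h′) k N ⟩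
  2 * (N + ∑ h′) + suc k      ≡⟨ cong (λ s → 2 * (s + ∑ h′) + suc k) hp≡N ⟨
  2 * (h p + ∑ h′) + suc k    ≡⟨ cong (λ s → 2 * s + suc k) (sum-remove h) ⟨
  2 * ∑ h + suc k             ∎
  where
  open ≤-Reasoning
  h′ = removeAt h p
  h′-inj : Injective _≡_ _≡_ h′
  h′-inj eq = Finₚ.punchIn-injective p _ _ (inj eq)
  h′<N : ∀ i → h′ i < N
  h′<N i = ≤∧≢⇒< (<⇒≤pred (h<N _)) (λ h′i≡N → Finₚ.punchInᵢ≢i p i (inj (trans h′i≡N (sym hp≡N))))
  k≤N : k ≤ N
  k≤N = distinct-below⇒≤ N h′ h′-inj h′<N
  expand : ∀ k → suc k * suc k ≡ k * k + 2 * k + 1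
  expand = solve-∀
  regroup : ∀ t k N → 2 * t + k + 2 * N + 1 ≡ 2 * (N + t) + suc k
  regroup = solve-∀

module _ {A : Set} where

  injective-into⇒≤-length : ∀ {k} (h : Fin k → A) → Injective _≡_ _≡_ h → (xs : List A) →
                            (∀ i → h i ∈ xs) → k ≤ length xs
  injective-into⇒≤-length h inj xs h∈xs = injective⇒≤ {f = index ∘ h∈xs} (λ eq → inj (begin
    h _                     ≡⟨ lookup-index (h∈xs _) ⟩
    lookup xs (index (h∈xs _)) ≡⟨ cong (lookup xs) eq ⟩
    lookup xs (index (h∈xs _)) ≡⟨ lookup-index (h∈xs _) ⟨
    h _                     ∎))
    where open ≡-Reasoning

  Unique⇒lookup-injective : ∀ {xs : List A} → Unique xs → Injective _≡_ _≡_ (lookup xs)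
  Unique⇒lookup-injective (x∉ ∷ u) {0F}        {0F}        eq = refl
  Unique⇒lookup-injective (x∉ ∷ u) {0F}        {Fin.suc j} eq = contradiction eq (All.lookup x∉ (∈-lookup j))
  Unique⇒lookup-injective (x∉ ∷ u) {Fin.suc i} {0F}        eq = contradiction (sym eq) (All.lookup x∉ (∈-lookup i))
  Unique⇒lookup-injective (x∉ ∷ u) {Fin.suc i} {Fin.suc j} eq = cong Fin.suc (Unique⇒lookup-injective u eq)

module _ (G : FinGraph) (f : Labeling G) where
  open FinGraph G using (E; verts; nEdges)
  open Bijection f using (to; injective; surjective)

  label-injective : Injective _≡_ _≡_ (label G f)
  label-injective eq = injective (Finₚ.toℕ-injective (suc-injective eq))

  label≤nEdges : ∀ e → label G f e ≤ nEdges
  label≤nEdges e = toℕ<n (to e)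

  top-label : .{{NonZero nEdges}} → ∃ λ e → label G f e ≡ nEdges
  top-label = e , (begin
    suc (toℕ (to e))  ≡⟨ cong (suc ∘ toℕ) (proj₂ (surjective top) refl) ⟩
    suc (toℕ top)     ≡⟨ cong suc (Finₚ.toℕ-fromℕ< _) ⟩
    suc (pred nEdges) ≡⟨ suc-pred nEdges ⟩
    nEdges            ∎)
    where
    open ≡-Reasoning
    top : Fin nEdges
    top = fromℕ< (≤-reflexive (suc-pred nEdges))
    e : E
    e = proj₁ (surjective top)

  module _ (verts-complete : ∀ x → x ∈ verts) where

    numColors-≥ : ∀ {k} (c : Fin k → ℕ) → Injective _≡_ _≡_ c →
                  (∀ i → ∃ λ x → vsum G f x ≡ c i) → k ≤ numColors G f
    numColors-≥ c inj attained = injective-into⇒≤-length c inj _ c∈colors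
      where
      c∈colors : ∀ i → c i ∈ deduplicate _≟_ (map (vsum G f) verts)
      c∈colors i with attained i
      ... | x , sum≡ci = ∈-deduplicate⁺ _≟_ (subst (_∈ _) sum≡ci (∈-map⁺ (vsum G f) (verts-complete x)))

  numColors-≤ : (zs : List ℕ) → (∀ x → vsum G f x ∈ zs) → numColors G f ≤ length zs
  numColors-≤ zs sums∈zs = injective-into⇒≤-length (lookup colors)
      (Unique⇒lookup-injective (deduplicate-! _≟_ sums)) zs color∈zs
    where
    sums colors : List ℕ
    sums = map (vsum G f) verts
    colors = deduplicate _≟_ sums
    color∈zs : ∀ i → lookup colors i ∈ zs
    color∈zs i with ∈-map⁻ (vsum G f) (∈-deduplicate⁻ _≟_ sums (∈-lookup i))
    ... | x , _ , color≡sum = subst (_∈ zs) (sym color≡sum) (sums∈zs x)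

-- Vertex sums of the spider

≟-refl : ∀ {n m} (x : SpV n m) → does (spV≟ x x) ≡ true
≟-refl x = dec-true (spV≟ x x) refl

≟-≢ : ∀ {n m} {x y : SpV n m} → x ≢ y → does (spV≟ x y) ≡ false
≟-≢ {x = x} {y} x≢y = dec-false (spV≟ x y) x≢y

module _ {n m : ℕ} (ω : SpE n m → ℕ) where

  contribution : SpV n m → SpE n m → ℕ
  contribution x e = if FinGraph.incident (Spider n m) x e then ω e else 0

  spiderSum : SpV n m → ℕ
  spiderSum x = sum (map (contribution x) (FinGraph.edges (Spider n m)))

  contribution-end₁ : ∀ e → contribution (proj₁ (spEnds e)) e ≡ ω e
  contribution-end₁ e rewrite ≟-refl (proj₁ (spEnds e)) = refl

  contribution-end₂ : ∀ e → contribution (proj₂ (spEnds e)) e ≡ ω e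
  -- b ∨ true is stuck on b, hence the case split.
  contribution-end₂ e rewrite ≟-refl (proj₂ (spEnds e)) with does (spV≟ (proj₂ (spEnds e)) (proj₁ (spEnds e)))
  ... | true  = refl
  ... | false = refl

  contribution-far : ∀ {x} e → x ≢ proj₁ (spEnds e) → x ≢ proj₂ (spEnds e) → contribution x e ≡ 0
  contribution-far e x≢end₁ x≢end₂ rewrite ≟-≢ x≢end₁ | ≟-≢ x≢end₂ = refl

  spiderSum-legs : ∀ x → spiderSum x ≡
    ∑[ i < n ] ∑[ s < 2 ] contribution x (e2 i s) + ∑[ j < m ] ∑[ s < 3 ] contribution x (e3 j s)
  spiderSum-legs x = trans (cong sum (map-++ (contribution x) legs₂ legs₃))
    (trans (sum-++ (map (contribution x) legs₂) _)
           (cong₂ _+_ (sum-map-allFin² (contribution x) e2) (sum-map-allFin² (contribution x) e3)))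
    where
    legs₂ = concatMap (λ i → map (e2 i) (allFin 2)) (allFin n)
    legs₃ = concatMap (λ j → map (e3 j) (allFin 3)) (allFin m)

  spiderSum-core : spiderSum core ≡ ∑[ i < n ] ω (e2 i 0F) + ∑[ j < m ] ω (e3 j 0F)
  spiderSum-core = trans (spiderSum-legs core) (cong₂ _+_ (sum-cong-≗ at-leg₂) (sum-cong-≗ at-leg₃))
    where
    at-leg₂ : ∀ i → ∑[ s < 2 ] contribution core (e2 i s) ≡ ω (e2 i 0F)
    at-leg₂ i = trans (∑-single (contribution core ∘ e2 i) 0F far) (contribution-end₁ (e2 i 0F))
      where
      far : ∀ s → s ≢ 0F → contribution core (e2 i s) ≡ 0
      far 0F 0≢0 = contradiction refl 0≢0
      far 1F _   = contribution-far {core} (e2 i 1F) (λ ()) (λ ())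
    at-leg₃ : ∀ j → ∑[ s < 3 ] contribution core (e3 j s) ≡ ω (e3 j 0F)
    at-leg₃ j = trans (∑-single (contribution core ∘ e3 j) 0F far) (contribution-end₁ (e3 j 0F))
      where
      far : ∀ s → s ≢ 0F → contribution core (e3 j s) ≡ 0
      far 0F 0≢0 = contradiction refl 0≢0
      far 1F _   = contribution-far {core} (e3 j 1F) (λ ()) (λ ())
      far 2F _   = contribution-far {core} (e3 j 2F) (λ ()) (λ ())

  spiderSum-leg2 : ∀ p s → spiderSum (leg2 p s) ≡ ∑[ t < 2 ] contribution (leg2 p s) (e2 p t)
  spiderSum-leg2 p s = begin
    spiderSum (leg2 p s)                                  ≡⟨ spiderSum-legs (leg2 p s) ⟩
    ∑[ i < n ] ∑[ t < 2 ] c (e2 i t) + ∑[ j < m ] ∑[ t < 3 ] c (e3 j t)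
      ≡⟨ cong₂ _+_ (∑-single _ p (λ i i≢p → ∑-≡0 _ (other-leg i≢p)))
                   (∑-≡0 _ (λ j → ∑-≡0 _ (leg₃ j))) ⟩
    ∑[ t < 2 ] c (e2 p t) + 0                             ≡⟨ +-identityʳ _ ⟩
    ∑[ t < 2 ] c (e2 p t)                                 ∎
    where
    open ≡-Reasoning
    c : SpE n m → ℕ
    c = contribution (leg2 p s)
    ≢leg : ∀ {i t} → i ≢ p → leg2 {m = m} p s ≢ leg2 i t
    ≢leg i≢p refl = i≢p refl
    other-leg : ∀ {i} → i ≢ p → ∀ t → c (e2 i t) ≡ 0
    other-leg {i} i≢p 0F = contribution-far {leg2 p s} (e2 i 0F) (λ ()) (≢leg i≢p)
    other-leg {i} i≢p 1F = contribution-far {leg2 p s} (e2 i 1F) (≢leg i≢p) (≢leg i≢p)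
    leg₃ : ∀ j t → c (e3 j t) ≡ 0
    leg₃ j 0F = contribution-far {leg2 p s} (e3 j 0F) (λ ()) (λ ())
    leg₃ j 1F = contribution-far {leg2 p s} (e3 j 1F) (λ ()) (λ ())
    leg₃ j 2F = contribution-far {leg2 p s} (e3 j 2F) (λ ()) (λ ())

  spiderSum-leg3 : ∀ p s → spiderSum (leg3 p s) ≡ ∑[ t < 3 ] contribution (leg3 p s) (e3 p t)
  spiderSum-leg3 p s = begin
    spiderSum (leg3 p s)                                  ≡⟨ spiderSum-legs (leg3 p s) ⟩
    ∑[ i < n ] ∑[ t < 2 ] c (e2 i t) + ∑[ j < m ] ∑[ t < 3 ] c (e3 j t)
      ≡⟨ cong₂ _+_ (∑-≡0 _ (λ i → ∑-≡0 _ (leg₂ i)))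
                   (∑-single _ p (λ j j≢p → ∑-≡0 _ (other-leg j≢p))) ⟩
    ∑[ t < 3 ] c (e3 p t)                                 ∎
    where
    open ≡-Reasoning
    c : SpE n m → ℕ
    c = contribution (leg3 p s)
    ≢leg : ∀ {j t} → j ≢ p → leg3 {n} p s ≢ leg3 j t
    ≢leg j≢p refl = j≢p refl
    leg₂ : ∀ i t → c (e2 i t) ≡ 0
    leg₂ i 0F = contribution-far {leg3 p s} (e2 i 0F) (λ ()) (λ ())
    leg₂ i 1F = contribution-far {leg3 p s} (e2 i 1F) (λ ()) (λ ())
    other-leg : ∀ {j} → j ≢ p → ∀ t → c (e3 j t) ≡ 0
    other-leg {j} j≢p 0F = contribution-far {leg3 p s} (e3 j 0F) (λ ()) (≢leg j≢p)
    other-leg {j} j≢p 1F = contribution-far {leg3 p s} (e3 j 1F) (≢leg j≢p) (≢leg j≢p)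
    other-leg {j} j≢p 2F = contribution-far {leg3 p s} (e3 j 2F) (≢leg j≢p) (≢leg j≢p)

  spiderSum-leg2-inner : ∀ p → spiderSum (leg2 p 0F) ≡ ω (e2 p 0F) + ω (e2 p 1F)
  spiderSum-leg2-inner p rewrite spiderSum-leg2 p 0F
    | contribution-end₂ (e2 p 0F) | contribution-end₁ (e2 p 1F) = cong (ω (e2 p 0F) +_) (+-identityʳ _)

  spiderSum-leg2-leaf : ∀ p → spiderSum (leg2 p 1F) ≡ ω (e2 p 1F)
  spiderSum-leg2-leaf p rewrite spiderSum-leg2 p 1F
    | contribution-far {leg2 p 1F} (e2 p 0F) (λ ()) (λ ()) | contribution-end₂ (e2 p 1F) = +-identityʳ _

  spiderSum-leg3-inner : ∀ p → spiderSum (leg3 p 0F) ≡ ω (e3 p 0F) + ω (e3 p 1F)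
  spiderSum-leg3-inner p rewrite spiderSum-leg3 p 0F
    | contribution-end₂ (e3 p 0F) | contribution-end₁ (e3 p 1F)
    | contribution-far {leg3 p 0F} (e3 p 2F) (λ ()) (λ ()) = cong (ω (e3 p 0F) +_) (+-identityʳ _)

  spiderSum-leg3-middle : ∀ p → spiderSum (leg3 p 1F) ≡ ω (e3 p 1F) + ω (e3 p 2F)
  spiderSum-leg3-middle p rewrite spiderSum-leg3 p 1F
    | contribution-far {leg3 p 1F} (e3 p 0F) (λ ()) (λ ())
    | contribution-end₂ (e3 p 1F) | contribution-end₁ (e3 p 2F) = cong (ω (e3 p 1F) +_) (+-identityʳ _)

  spiderSum-leg3-leaf : ∀ p → spiderSum (leg3 p 2F) ≡ ω (e3 p 2F)
  spiderSum-leg3-leaf p rewrite spiderSum-leg3 p 2F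
    | contribution-far {leg3 p 2F} (e3 p 0F) (λ ()) (λ ())
    | contribution-far {leg3 p 2F} (e3 p 1F) (λ ()) (λ ()) | contribution-end₂ (e3 p 2F) = +-identityʳ _

module _ {n m : ℕ} where

  legEdge : Fin 2 → Fin 3 → Fin (n + m) → SpE n m
  legEdge s₂ s₃ i = [ (λ a → e2 a s₂) , (λ b → e3 b s₃) ] (splitAt n i)

  coreEdge leafEdge : Fin (n + m) → SpE n m
  coreEdge = legEdge 0F 0F
  leafEdge = legEdge 1F 2F

  leaf : Fin (n + m) → SpV n m
  leaf i = [ (λ a → leg2 a 1F) , (λ b → leg3 b 2F) ] (splitAt n i)

  legEdge-injective : ∀ s₂ s₃ → Injective _≡_ _≡_ (legEdge s₂ s₃)
  legEdge-injective s₂ s₃ {i} {i′} eq = begin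
    i                   ≡⟨ Finₚ.join-splitAt n m i ⟨
    join n m (splitAt n i)  ≡⟨ cong (join n m) (legs-injective (splitAt n i) (splitAt n i′) eq) ⟩
    join n m (splitAt n i′) ≡⟨ Finₚ.join-splitAt n m i′ ⟩
    i′                  ∎
    where
    open ≡-Reasoning
    legs-injective : ∀ x y → [ (λ a → e2 a s₂) , (λ b → e3 b s₃) ] x ≡ [ (λ a → e2 a s₂) , (λ b → e3 b s₃) ] y → x ≡ y
    legs-injective (inj₁ a) (inj₁ .a) refl = refl
    legs-injective (inj₂ b) (inj₂ .b) refl = refl

  legEdge-↑ˡ : ∀ s₂ s₃ a → legEdge s₂ s₃ (a ↑ˡ m) ≡ e2 a s₂
  legEdge-↑ˡ s₂ s₃ a rewrite Finₚ.splitAt-↑ˡ n a m = refl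

  legEdge-↑ʳ : ∀ s₂ s₃ b → legEdge s₂ s₃ (n ↑ʳ b) ≡ e3 b s₃
  legEdge-↑ʳ s₂ s₃ b rewrite Finₚ.splitAt-↑ʳ n m b = refl

  module _ (ω : SpE n m → ℕ) where

    spiderSum-leaf : ∀ i → spiderSum ω (leaf i) ≡ ω (leafEdge i)
    spiderSum-leaf i with splitAt n i
    ... | inj₁ a = spiderSum-leg2-leaf ω a
    ... | inj₂ b = spiderSum-leg3-leaf ω b

    spiderSum-core-legs : spiderSum ω core ≡ ∑ (ω ∘ coreEdge)
    spiderSum-core-legs = begin
      spiderSum ω core                                      ≡⟨ spiderSum-core ω ⟩
      ∑[ a < n ] ω (e2 a 0F) + ∑[ b < m ] ω (e3 b 0F)       ≡⟨ cong₂ _+_ (sum-cong-≗ (cong ω ∘ legEdge-↑ˡ 0F 0F))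
                                                                        (sum-cong-≗ (cong ω ∘ legEdge-↑ʳ 0F 0F)) ⟨
      ∑[ a < n ] ω (coreEdge (a ↑ˡ m)) + ∑[ b < m ] ω (coreEdge (n ↑ʳ b)) ≡⟨ ∑-↑ n (ω ∘ coreEdge) ⟨
      ∑ (ω ∘ coreEdge)                                      ∎
      where open ≡-Reasoning

    inner-end : ∀ e → ∃ λ w → ∃ λ e′ → e′ ≢ e × spiderSum ω w ≡ ω e + ω e′
    inner-end (e2 a 0F) = leg2 a 0F , e2 a 1F , (λ ()) , spiderSum-leg2-inner ω a
    inner-end (e2 a 1F) = leg2 a 0F , e2 a 0F , (λ ()) , trans (spiderSum-leg2-inner ω a) (+-comm (ω (e2 a 0F)) _)
    inner-end (e3 b 0F) = leg3 b 0F , e3 b 1F , (λ ()) , spiderSum-leg3-inner ω b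
    inner-end (e3 b 1F) = leg3 b 0F , e3 b 0F , (λ ()) , trans (spiderSum-leg3-inner ω b) (+-comm (ω (e3 b 0F)) _)
    inner-end (e3 b 2F) = leg3 b 1F , e3 b 1F , (λ ()) , trans (spiderSum-leg3-middle ω b) (+-comm (ω (e3 b 1F)) _)

  spider-verts-complete : ∀ x → x ∈ FinGraph.verts (Spider n m)
  spider-verts-complete core       = here refl
  spider-verts-complete (leg2 a s) = there (∈-++⁺ˡ (∈-concat⁺′ (∈-map⁺ (leg2 a) (∈-allFin s)) (∈-map⁺ _ (∈-allFin a))))
  spider-verts-complete (leg3 b s) = there (∈-++⁺ʳ _ (∈-concat⁺′ (∈-map⁺ (leg3 b) (∈-allFin s)) (∈-map⁺ _ (∈-allFin b))))

-- The numerical condition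

-- (n + m)(n + m + 1)/2, the least possible sum at the core, is at least twice the number of edges.
CoreBound : ℕ → ℕ → Set
CoreBound n m = 4 * (2 * n + 3 * m) ≤ (n + m) * suc (n + m)

CoreBound-sucᵐ : ∀ {n m} → 5 ≤ n + m → CoreBound n m → CoreBound n (suc m)
CoreBound-sucᵐ {n} {m} 5≤k bound = begin
  4 * (2 * n + 3 * suc m)                          ≡⟨ lhs n m ⟩
  4 * (2 * n + 3 * m) + 2 * 6                      ≤⟨ +-mono-≤ bound (*-monoʳ-≤ 2 (s≤s 5≤k)) ⟩
  (n + m) * suc (n + m) + 2 * suc (n + m)          ≡⟨ rhs n m ⟩
  (n + suc m) * suc (n + suc m)                    ∎
  where
  open ≤-Reasoning
  lhs : ∀ n m → 4 * (2 * n + 3 * suc m) ≡ 4 * (2 * n + 3 * m) + 2 * 6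
  lhs = solve-∀
  rhs : ∀ n m → (n + m) * suc (n + m) + 2 * suc (n + m) ≡ (n + suc m) * suc (n + suc m)
  rhs = solve-∀

CoreBound-sucⁿ : ∀ {n m} → 3 ≤ n + m → CoreBound n m → CoreBound (suc n) m
CoreBound-sucⁿ {n} {m} 3≤k bound = begin
  4 * (2 * suc n + 3 * m)                          ≡⟨ lhs n m ⟩
  4 * (2 * n + 3 * m) + 2 * 4                      ≤⟨ +-mono-≤ bound (*-monoʳ-≤ 2 (s≤s 3≤k)) ⟩
  (n + m) * suc (n + m) + 2 * suc (n + m)          ≡⟨ rhs n m ⟩
  (suc n + m) * suc (suc n + m)                    ∎
  where
  open ≤-Reasoning
  lhs : ∀ n m → 4 * (2 * suc n + 3 * m) ≡ 4 * (2 * n + 3 * m) + 2 * 4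
  lhs = solve-∀
  rhs : ∀ n m → (n + m) * suc (n + m) + 2 * suc (n + m) ≡ (suc n + m) * suc (suc n + m)
  rhs = solve-∀

CoreBound-monoᵐ : ∀ {n m m′} → 5 ≤ n + m → m ≤′ m′ → CoreBound n m → CoreBound n m′
CoreBound-monoᵐ     5≤k ≤′-refl        bound = bound
CoreBound-monoᵐ {n} 5≤k (≤′-step m≤m′) bound =
  CoreBound-sucᵐ {n} (≤-trans 5≤k (+-monoʳ-≤ n (≤′⇒≤ m≤m′))) (CoreBound-monoᵐ 5≤k m≤m′ bound)

CoreBound-monoⁿ : ∀ {n n′ m} → 3 ≤ n + m → n ≤′ n′ → CoreBound n m → CoreBound n′ m
CoreBound-monoⁿ         3≤k ≤′-refl        bound = bound
CoreBound-monoⁿ {m = m} 3≤k (≤′-step n≤n′) bound =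
  CoreBound-sucⁿ {m = m} (≤-trans 3≤k (+-monoˡ-≤ m (≤′⇒≤ n≤n′))) (CoreBound-monoⁿ 3≤k n≤n′ bound)

-- Each row n ≤ 6 of A is followed by a pair (n, M) where the bound holds by evaluation; from there,
-- and from (7, 1), it propagates to all larger n and m.
CoreBound-outside-A : ∀ n m → 1 ≤ m → 3 ≤ n + m → ¬ InA n m → CoreBound n m
CoreBound-outside-A 0 m 1≤m 3≤k ∉A with 11 ≤? m
... | yes 11≤m = CoreBound-monoᵐ {0} {11} (≤ᵇ⇒≤ 5 11 _) (≤⇒≤′ 11≤m) (≤ᵇ⇒≤ _ _ _)
... | no  11≰m = contradiction (inj₁ (refl , 3≤k , ≤-pred (≰⇒> 11≰m))) ∉A
CoreBound-outside-A 1 m 1≤m 3≤k ∉A with 10 ≤? m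
... | yes 10≤m = CoreBound-monoᵐ {1} {10} (≤ᵇ⇒≤ 5 11 _) (≤⇒≤′ 10≤m) (≤ᵇ⇒≤ _ _ _)
... | no  10≰m = contradiction (inj₂ (inj₁ (refl , ≤-pred 3≤k , ≤-pred (≰⇒> 10≰m)))) ∉A
CoreBound-outside-A 2 m 1≤m 3≤k ∉A with 9 ≤? m
... | yes 9≤m = CoreBound-monoᵐ {2} {9} (≤ᵇ⇒≤ 5 11 _) (≤⇒≤′ 9≤m) (≤ᵇ⇒≤ _ _ _)
... | no  9≰m = contradiction (inj₂ (inj₂ (inj₁ (refl , 1≤m , ≤-pred (≰⇒> 9≰m))))) ∉A
CoreBound-outside-A 3 m 1≤m 3≤k ∉A with 7 ≤? m
... | yes 7≤m = CoreBound-monoᵐ {3} {7} (≤ᵇ⇒≤ 5 10 _) (≤⇒≤′ 7≤m) (≤ᵇ⇒≤ _ _ _)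
... | no  7≰m = contradiction (inj₂ (inj₂ (inj₂ (inj₁ (refl , 1≤m , ≤-pred (≰⇒> 7≰m)))))) ∉A
CoreBound-outside-A 4 m 1≤m 3≤k ∉A with 6 ≤? m
... | yes 6≤m = CoreBound-monoᵐ {4} {6} (≤ᵇ⇒≤ 5 10 _) (≤⇒≤′ 6≤m) (≤ᵇ⇒≤ _ _ _)
... | no  6≰m = contradiction (inj₂ (inj₂ (inj₂ (inj₂ (inj₁ (refl , 1≤m , ≤-pred (≰⇒> 6≰m))))))) ∉A
CoreBound-outside-A 5 m 1≤m 3≤k ∉A with 4 ≤? m
... | yes 4≤m = CoreBound-monoᵐ {5} {4} (≤ᵇ⇒≤ 5 9 _) (≤⇒≤′ 4≤m) (≤ᵇ⇒≤ _ _ _)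
... | no  4≰m = contradiction (inj₂ (inj₂ (inj₂ (inj₂ (inj₂ (inj₁ (refl , 1≤m , ≤-pred (≰⇒> 4≰m)))))))) ∉A
CoreBound-outside-A 6 m 1≤m 3≤k ∉A with 2 ≤? m
... | yes 2≤m = CoreBound-monoᵐ {6} {2} (≤ᵇ⇒≤ 5 8 _) (≤⇒≤′ 2≤m) (≤ᵇ⇒≤ _ _ _)
... | no  2≰m = contradiction (inj₂ (inj₂ (inj₂ (inj₂ (inj₂ (inj₂ (refl , ≤-antisym (≤-pred (≰⇒> 2≰m)) 1≤m))))))) ∉A
CoreBound-outside-A n@(suc (suc (suc (suc (suc (suc (suc a))))))) m 1≤m 3≤k ∉A =
  CoreBound-monoⁿ {7} {n} (≤-trans (≤ᵇ⇒≤ 3 7 _) (m≤m+n 7 m)) (≤⇒≤′ (m≤m+n 7 a))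
    (CoreBound-monoᵐ {7} {1} (≤ᵇ⇒≤ 5 8 _) (≤⇒≤′ 1≤m) (≤ᵇ⇒≤ _ _ _))

-- The lower bound

n+m≤2n+3m : ∀ n m → n + m ≤ 2 * n + 3 * m
n+m≤2n+3m n m = +-mono-≤ (m≤m+n n _) (m≤m+n m _)

∷-injective : ∀ {k a} {h : Fin k → ℕ} → Injective _≡_ _≡_ h → (∀ i → h i < a) →
              Injective _≡_ _≡_ (a Vector.∷ h)
∷-injective inj h<a {0F}        {0F}        eq = refl
∷-injective inj h<a {0F}        {Fin.suc j} eq = contradiction (sym eq) (<⇒≢ (h<a j))
∷-injective inj h<a {Fin.suc i} {0F}        eq = contradiction eq (<⇒≢ (h<a i))
∷-injective inj h<a {Fin.suc i} {Fin.suc j} eq = cong Fin.suc (inj eq)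

module _ {n m : ℕ} (f : Labeling (Spider n m)) where
  private
    G = Spider n m
    ℓ = label G f
    q k : ℕ
    q = 2 * n + 3 * m
    k = n + m

  core-sum-large : CoreBound n m → 2 * q ≤ vsum G f core
  core-sum-large bound = *-cancelˡ-≤ 2 (begin
    2 * (2 * q)        ≡⟨ *-assoc 2 2 q ⟨
    4 * q              ≤⟨ bound ⟩
    k * suc k          ≡⟨ *-suc k k ⟩
    k + k * k          ≤⟨ +-monoʳ-≤ k (∑-distinct-≥ q h h-injective (λ i → toℕ<n _)) ⟩
    k + (2 * ∑ h + k)  ≡⟨ regroup k (∑ h) ⟩
    2 * (k + ∑ h)      ≡⟨ cong (2 *_) (∑-suc h) ⟨
    2 * ∑ (suc ∘ h)    ≡⟨ cong (2 *_) (spiderSum-core-legs ℓ) ⟨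
    2 * vsum G f core  ∎)
    where
    open ≤-Reasoning
    h : Fin k → ℕ
    h = toℕ ∘ Bijection.to f ∘ coreEdge
    h-injective : Injective _≡_ _≡_ h
    h-injective = legEdge-injective 0F 0F ∘ label-injective G f ∘ cong suc
    regroup : ∀ k t → k + (2 * t + k) ≡ 2 * (k + t)
    regroup = solve-∀

  sum-between-q-and-2q : .{{NonZero q}} → ∃ λ w → q < vsum G f w × vsum G f w < 2 * q
  sum-between-q-and-2q with top-label G f
  ... | eₜ , ℓeₜ≡q with inner-end ℓ eₜ
  ... | w , e′ , e′≢eₜ , w-sum =
    w , subst (q <_) (sym w-sum′) (m<m+n q z<s)
      , subst (_< 2 * q) (sym w-sum′) (+-monoʳ-< q (<-≤-trans ℓe′<q (m≤m+n q 0)))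
    where
    w-sum′ : vsum G f w ≡ q + ℓ e′
    w-sum′ = trans w-sum (cong (_+ ℓ e′) ℓeₜ≡q)
    ℓe′<q : ℓ e′ < q
    ℓe′<q = ≤∧≢⇒< (label≤nEdges G f e′) (λ ℓe′≡q → e′≢eₜ (label-injective G f (trans ℓe′≡q (sym ℓeₜ≡q))))

  numColors-lower : 1 ≤ k → CoreBound n m → k + 2 ≤ numColors G f
  numColors-lower 1≤k bound with sum-between-q-and-2q {{>-nonZero (≤-trans 1≤k (n+m≤2n+3m n m))}}
  ... | w , q<w , w<2q = subst (_≤ numColors G f) (+-comm 2 k)
    (numColors-≥ G f spider-verts-complete colors colors-injective attained)
    where
    w<core : vsum G f w < vsum G f core
    w<core = <-≤-trans w<2q (core-sum-large bound)
    leaves : Fin k → ℕ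
    leaves = ℓ ∘ leafEdge
    colors : Fin (2 + k) → ℕ
    colors = vsum G f core Vector.∷ vsum G f w Vector.∷ leaves
    leaves<w : ∀ i → leaves i < vsum G f w
    leaves<w i = ≤-<-trans (label≤nEdges G f _) q<w
    below-core : ∀ i → (vsum G f w Vector.∷ leaves) i < vsum G f core
    below-core 0F          = w<core
    below-core (Fin.suc i) = <-trans (leaves<w i) w<core
    colors-injective : Injective _≡_ _≡_ colors
    colors-injective = ∷-injective (∷-injective (legEdge-injective 1F 2F ∘ label-injective G f) leaves<w) below-core
    attained : ∀ i → ∃ λ x → vsum G f x ≡ colors i
    attained 0F                    = core , refl
    attained 1F                    = w , refl
    attained (Fin.suc (Fin.suc i)) = leaf i , spiderSum-leaf ℓ i

-- The labeling

cast↔ : ∀ {a b} → a ≡ b → Fin a ↔ Fin b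
cast↔ eq = mk↔ₛ′ (Fin.cast eq) (Fin.cast (sym eq)) (Finₚ.cast-involutive eq (sym eq)) (Finₚ.cast-involutive (sym eq) eq)

toℕ-opposite+suc : ∀ {k} (i : Fin k) → toℕ (opposite i) + suc (toℕ i) ≡ k
toℕ-opposite+suc i = trans (cong (_+ suc (toℕ i)) (Finₚ.opposite-prop i)) (m∸n+n≡m (toℕ<n i))

-- Labels 1, …, q are dealt out in five blocks: middle edges of the 3-legs, core edges of the
-- 2-legs, core edges of the 3-legs, outer edges of the 2-legs, outer edges of the 3-legs.
-- Reversing the last three blocks makes every neighbour of a leaf sum to q + 1 and every core
-- neighbour on a 3-leg sum to n + 2m + 1, which is also the label of an outer edge.
module Construction (n m : ℕ) where

  Blocks : Set
  Blocks = Fin m ⊎ (Fin n ⊎ (Fin m ⊎ (Fin n ⊎ Fin m)))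

  toBlocks : SpE n m → Blocks
  toBlocks (e3 j 1F) = inj₁ j
  toBlocks (e2 i 0F) = inj₂ (inj₁ i)
  toBlocks (e3 j 0F) = inj₂ (inj₂ (inj₁ (opposite j)))
  toBlocks (e2 i 1F) = inj₂ (inj₂ (inj₂ (inj₁ (opposite i))))
  toBlocks (e3 j 2F) = inj₂ (inj₂ (inj₂ (inj₂ (opposite j))))

  fromBlocks : Blocks → SpE n m
  fromBlocks (inj₁ j)                      = e3 j 1F
  fromBlocks (inj₂ (inj₁ i))               = e2 i 0F
  fromBlocks (inj₂ (inj₂ (inj₁ j)))        = e3 (opposite j) 0F
  fromBlocks (inj₂ (inj₂ (inj₂ (inj₁ i)))) = e2 (opposite i) 1F
  fromBlocks (inj₂ (inj₂ (inj₂ (inj₂ j)))) = e3 (opposite j) 2F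

  edges↔blocks : SpE n m ↔ Blocks
  edges↔blocks = mk↔ₛ′ toBlocks fromBlocks to∘from from∘to
    where
    to∘from : ∀ b → toBlocks (fromBlocks b) ≡ b
    to∘from (inj₁ j)                      = refl
    to∘from (inj₂ (inj₁ i))               = refl
    to∘from (inj₂ (inj₂ (inj₁ j)))        = cong (inj₂ ∘ inj₂ ∘ inj₁) (opposite-involutive j)
    to∘from (inj₂ (inj₂ (inj₂ (inj₁ i)))) = cong (inj₂ ∘ inj₂ ∘ inj₂ ∘ inj₁) (opposite-involutive i)
    to∘from (inj₂ (inj₂ (inj₂ (inj₂ j)))) = cong (inj₂ ∘ inj₂ ∘ inj₂ ∘ inj₂) (opposite-involutive j)
    from∘to : ∀ e → fromBlocks (toBlocks e) ≡ e
    from∘to (e3 j 1F) = refl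
    from∘to (e2 i 0F) = refl
    from∘to (e3 j 0F) = cong (λ j → e3 j 0F) (opposite-involutive j)
    from∘to (e2 i 1F) = cong (λ i → e2 i 1F) (opposite-involutive i)
    from∘to (e3 j 2F) = cong (λ j → e3 j 2F) (opposite-involutive j)

  blocks↔Fin : Blocks ↔ Fin (2 * n + 3 * m)
  blocks↔Fin = ↔-trans (↔-sym (↔-trans +↔⊎ (↔-refl ⊎-↔ ↔-trans +↔⊎ (↔-refl ⊎-↔ ↔-trans +↔⊎ (↔-refl ⊎-↔ +↔⊎)))))
                       (cast↔ (size n m))
    where
    size : ∀ n m → m + (n + (m + (n + m))) ≡ 2 * n + 3 * m
    size = solve-∀

  labeling : Labeling (Spider n m)
  labeling = ↔⇒⤖ (↔-trans edges↔blocks blocks↔Fin)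

  ℓ : SpE n m → ℕ
  ℓ = label (Spider n m) labeling

  ℓ-e3-1 : ∀ j → ℓ (e3 j 1F) ≡ suc (toℕ j)
  ℓ-e3-1 j = cong suc (trans (toℕ-cast _ _) (toℕ-↑ˡ j _))

  ℓ-e2-0 : ∀ i → ℓ (e2 i 0F) ≡ suc (m + toℕ i)
  ℓ-e2-0 i = cong suc (trans (toℕ-cast _ _) (trans (toℕ-↑ʳ m _) (cong (m +_) (toℕ-↑ˡ i _))))

  ℓ-e3-0 : ∀ j → ℓ (e3 j 0F) ≡ suc (m + (n + toℕ (opposite j)))
  ℓ-e3-0 j = cong suc (trans (toℕ-cast _ _) (trans (toℕ-↑ʳ m _) (cong (m +_)
               (trans (toℕ-↑ʳ n _) (cong (n +_) (toℕ-↑ˡ (opposite j) _))))))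

  ℓ-e2-1 : ∀ i → ℓ (e2 i 1F) ≡ suc (m + (n + (m + toℕ (opposite i))))
  ℓ-e2-1 i = cong suc (trans (toℕ-cast _ _) (trans (toℕ-↑ʳ m _) (cong (m +_)
               (trans (toℕ-↑ʳ n _) (cong (n +_) (trans (toℕ-↑ʳ m _) (cong (m +_) (toℕ-↑ˡ (opposite i) _))))))))

  ℓ-e3-2 : ∀ j → ℓ (e3 j 2F) ≡ suc (m + (n + (m + (n + toℕ (opposite j)))))
  ℓ-e3-2 j = cong suc (trans (toℕ-cast _ _) (trans (toℕ-↑ʳ m _) (cong (m +_)
               (trans (toℕ-↑ʳ n _) (cong (n +_) (trans (toℕ-↑ʳ m _) (cong (m +_) (toℕ-↑ʳ n _))))))))

  private
    q U : ℕ
    q = 2 * n + 3 * m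
    U = suc (n + 2 * m)

  leg2-inner-sum : ∀ i → spiderSum ℓ (leg2 i 0F) ≡ suc q
  leg2-inner-sum i = begin
    spiderSum ℓ (leg2 i 0F)                                   ≡⟨ spiderSum-leg2-inner ℓ i ⟩
    ℓ (e2 i 0F) + ℓ (e2 i 1F)                                 ≡⟨ cong₂ _+_ (ℓ-e2-0 i) (ℓ-e2-1 i) ⟩
    suc (m + toℕ i) + suc (m + (n + (m + toℕ (opposite i))))  ≡⟨ regroup m n (toℕ i) _ ⟩
    (toℕ (opposite i) + suc (toℕ i)) + suc (n + 3 * m)        ≡⟨ cong (_+ suc (n + 3 * m)) (toℕ-opposite+suc i) ⟩
    n + suc (n + 3 * m)                                       ≡⟨ total m n ⟩
    suc q                                                     ∎
    where
    open ≡-Reasoning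
    regroup : ∀ m n x y → suc (m + x) + suc (m + (n + (m + y))) ≡ (y + suc x) + suc (n + 3 * m)
    regroup = solve-∀
    total : ∀ m n → n + suc (n + 3 * m) ≡ suc (2 * n + 3 * m)
    total = solve-∀

  leg3-middle-sum : ∀ j → spiderSum ℓ (leg3 j 1F) ≡ suc q
  leg3-middle-sum j = begin
    spiderSum ℓ (leg3 j 1F)                                   ≡⟨ spiderSum-leg3-middle ℓ j ⟩
    ℓ (e3 j 1F) + ℓ (e3 j 2F)                                 ≡⟨ cong₂ _+_ (ℓ-e3-1 j) (ℓ-e3-2 j) ⟩
    suc (toℕ j) + suc (m + (n + (m + (n + toℕ (opposite j))))) ≡⟨ regroup m n (toℕ j) _ ⟩
    (toℕ (opposite j) + suc (toℕ j)) + suc (2 * n + 2 * m)    ≡⟨ cong (_+ suc (2 * n + 2 * m)) (toℕ-opposite+suc j) ⟩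
    m + suc (2 * n + 2 * m)                                   ≡⟨ total m n ⟩
    suc q                                                     ∎
    where
    open ≡-Reasoning
    regroup : ∀ m n x y → suc x + suc (m + (n + (m + (n + y)))) ≡ (y + suc x) + suc (2 * n + 2 * m)
    regroup = solve-∀
    total : ∀ m n → m + suc (2 * n + 2 * m) ≡ suc (2 * n + 3 * m)
    total = solve-∀

  leg3-inner-sum : ∀ j → spiderSum ℓ (leg3 j 0F) ≡ U
  leg3-inner-sum j = begin
    spiderSum ℓ (leg3 j 0F)                                   ≡⟨ spiderSum-leg3-inner ℓ j ⟩
    ℓ (e3 j 0F) + ℓ (e3 j 1F)                                 ≡⟨ cong₂ _+_ (ℓ-e3-0 j) (ℓ-e3-1 j) ⟩
    suc (m + (n + toℕ (opposite j))) + suc (toℕ j)            ≡⟨ regroup m n (toℕ j) _ ⟩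
    (toℕ (opposite j) + suc (toℕ j)) + suc (n + m)            ≡⟨ cong (_+ suc (n + m)) (toℕ-opposite+suc j) ⟩
    m + suc (n + m)                                           ≡⟨ total m n ⟩
    U                                                         ∎
    where
    open ≡-Reasoning
    regroup : ∀ m n x y → suc (m + (n + y)) + suc x ≡ (y + suc x) + suc (n + m)
    regroup = solve-∀
    total : ∀ m n → m + suc (n + m) ≡ suc (n + 2 * m)
    total = solve-∀

n+2m+1-is-leafLabel : ∀ n m → 1 ≤ m → ∃ λ p → Construction.ℓ n m (leafEdge p) ≡ suc (n + 2 * m)
n+2m+1-is-leafLabel (suc n) m _ = opposite 0F ↑ˡ m , (begin
  ℓ (leafEdge (opposite 0F ↑ˡ m))                            ≡⟨ cong ℓ (legEdge-↑ˡ 1F 2F (opposite 0F)) ⟩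
  ℓ (e2 (opposite 0F) 1F)                                    ≡⟨ ℓ-e2-1 (opposite 0F) ⟩
  suc (m + (suc n + (m + toℕ (opposite (opposite 0F)))))     ≡⟨ cong (λ i → suc (m + (suc n + (m + toℕ i)))) (opposite-involutive {suc n} 0F) ⟩
  suc (m + (suc n + (m + 0)))                                ≡⟨ regroup m n ⟩
  suc (suc n + 2 * m)                                        ∎)
  where
  open Construction (suc n) m
  open ≡-Reasoning
  regroup : ∀ m n → suc (m + (suc n + (m + 0))) ≡ suc (suc n + 2 * m)
  regroup = solve-∀
n+2m+1-is-leafLabel zero (suc m) _ = 0 ↑ʳ opposite 0F , (begin
  ℓ (leafEdge (0 ↑ʳ opposite 0F))                            ≡⟨ cong ℓ (legEdge-↑ʳ 1F 2F (opposite 0F)) ⟩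
  ℓ (e3 (opposite 0F) 2F)                                    ≡⟨ ℓ-e3-2 (opposite 0F) ⟩
  suc (suc m + (0 + (suc m + (0 + toℕ (opposite (opposite 0F))))))
                                                             ≡⟨ cong (λ i → suc (suc m + (suc m + toℕ i))) (opposite-involutive {suc m} 0F) ⟩
  suc (suc m + (suc m + 0))                                  ≡⟨ regroup m ⟩
  suc (0 + 2 * suc m)                                        ∎)
  where
  open Construction 0 (suc m)
  open ≡-Reasoning
  regroup : ∀ m → suc (suc m + (suc m + 0)) ≡ suc (0 + 2 * suc m)
  regroup = solve-∀

module _ {n m : ℕ} where
  open Construction n m
  private
    G = Spider n m
    q = 2 * n + 3 * m
    U = suc (n + 2 * m)

  U≤q : 1 ≤ n + m → U ≤ q
  U≤q 1≤k = begin
    suc (n + 2 * m)        ≡⟨ +-comm 1 (n + 2 * m) ⟩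
    n + 2 * m + 1          ≤⟨ +-monoʳ-≤ (n + 2 * m) 1≤k ⟩
    n + 2 * m + (n + m)    ≡⟨ regroup n m ⟩
    q                      ∎
    where
    open ≤-Reasoning
    regroup : ∀ n m → n + 2 * m + (n + m) ≡ 2 * n + 3 * m
    regroup = solve-∀

  q+1<core : 3 ≤ n + m → CoreBound n m → suc q < vsum G labeling core
  q+1<core 3≤k bound = <-≤-trans q+1<2q (core-sum-large labeling bound)
    where
    q+1<2q : suc q < 2 * q
    q+1<2q = +-mono-≤ (≤-trans (s≤s (s≤s z≤n)) (≤-trans 3≤k (n+m≤2n+3m n m))) (m≤m+n q 0)

  labeling-localAntimagic : 3 ≤ n + m → CoreBound n m → IsLocalAntimagic G labeling
  labeling-localAntimagic 3≤k bound (e2 i 0F) eq = >⇒≢ (q+1<core 3≤k bound) (trans eq (leg2-inner-sum i))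
  labeling-localAntimagic 3≤k bound (e2 i 1F) eq =
    >⇒≢ (s≤s (label≤nEdges G labeling (e2 i 1F))) (trans (sym (leg2-inner-sum i)) (trans eq (spiderSum-leg2-leaf ℓ i)))
  labeling-localAntimagic 3≤k bound (e3 j 0F) eq =
    >⇒≢ (≤-<-trans (U≤q (≤-trans (s≤s z≤n) 3≤k)) (<-trans (n<1+n q) (q+1<core 3≤k bound))) (trans eq (leg3-inner-sum j))
  labeling-localAntimagic 3≤k bound (e3 j 1F) eq =
    <⇒≢ (s≤s (U≤q (≤-trans (s≤s z≤n) 3≤k))) (trans (sym (leg3-inner-sum j)) (trans eq (leg3-middle-sum j)))
  labeling-localAntimagic 3≤k bound (e3 j 2F) eq =
    >⇒≢ (s≤s (label≤nEdges G labeling (e3 j 2F))) (trans (sym (leg3-middle-sum j)) (trans eq (spiderSum-leg3-leaf ℓ j)))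

  labeling-numColors≤ : 1 ≤ m → numColors G labeling ≤ n + m + 2
  labeling-numColors≤ 1≤m = subst (numColors G labeling ≤_) (+-comm 2 (n + m))
    (subst (λ l → numColors G labeling ≤ 2 + l) (length-tabulate leafLabels)
      (numColors-≤ G labeling (suc q ∷ vsum G labeling core ∷ tabulate leafLabels) sum∈))
    where
    leafLabels : Fin (n + m) → ℕ
    leafLabels = ℓ ∘ leafEdge
    leafLabel∈ : ∀ p {s} → leafLabels p ≡ s → s ∈ suc q ∷ vsum G labeling core ∷ tabulate leafLabels
    leafLabel∈ p refl = there (there (∈-tabulate⁺ p))
    sum∈ : ∀ x → vsum G labeling x ∈ suc q ∷ vsum G labeling core ∷ tabulate leafLabels
    sum∈ core        = there (here refl)
    sum∈ (leg2 i 0F) = here (leg2-inner-sum i)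
    sum∈ (leg2 i 1F) = leafLabel∈ (i ↑ˡ m) (trans (cong ℓ (legEdge-↑ˡ 1F 2F i)) (sym (spiderSum-leg2-leaf ℓ i)))
    sum∈ (leg3 j 0F) with n+2m+1-is-leafLabel n m 1≤m
    ... | p , ℓp≡n+2m+1 = leafLabel∈ p (trans ℓp≡n+2m+1 (sym (leg3-inner-sum j)))
    sum∈ (leg3 j 1F) = here (leg3-middle-sum j)
    sum∈ (leg3 j 2F) = leafLabel∈ (n ↑ʳ j) (trans (cong ℓ (legEdge-↑ʳ 1F 2F j)) (sym (spiderSum-leg3-leaf ℓ j)))

theorem2p7 : (n m : ℕ) → 1 ≤ m → 3 ≤ n + m → ¬ InA n m →
    χla≡ (Spider n m) (n + m + 2)
theorem2p7 n m 1≤m 3≤k ∉A =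
  (labeling , labeling-localAntimagic 3≤k bound , ≤-antisym (labeling-numColors≤ 1≤m) (lower labeling)) ,
  (λ f _ → lower f)
  where
  open Construction n m using (labeling)
  bound : CoreBound n m
  bound = CoreBound-outside-A n m 1≤m 3≤k ∉A
  lower : (f : Labeling (Spider n m)) → n + m + 2 ≤ numColors (Spider n m) f
  lower f = numColors-lower f (≤-trans (s≤s z≤n) 3≤k) bound
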